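{- Let $\gamma,\alpha,\eta,\delta$ be umbrae, let $(s_n(x))_{n\ge0}$ with $s_n(x)=\sum_{k=0}^ns_{n,k}x^k$ be the Sheffer sequence of $(\gamma,\alpha)$ and let $(r_n(x))_{n\ge0}$ be the Sheffer sequence of $(\eta,\delta)$. Then the umbral composition $\bigl(s_n(\mathbf r(x))\bigr)_{n\ge0}$, defined by $s_n(\mathbf r(x))=\sum_{k=0}^ns_{n,k}r_k(x)$, is the Sheffer sequence of \[ \bigl(\gamma+\eta\boldsymbol{\cdot}\beta\boldsymbol{\cdot}\alpha_D,\ \alpha+\delta\boldsymbol{\cdot}\beta\boldsymbol{\cdot}\alpha_D\bigr). \]
   Context: Umbral calculus setting. Fix a finite set $\mathbf{x}$ of commuting variables (containing $x$) and a further variable $z$. To every formal power series $f(z)\in\mathbb{C}[\mathbf{x}][[z]]$ with $f(0)=1$ a symbol (its umbra) is attached. The evaluation $E$ is the $\mathbb{C}[\mathbf{x}]$-linear functional on polynomials in umbrae with coefficients in $\mathbb{C}[\mathbf{x}]$ such that $E[\alpha^n]=n![z^n]f(z)$ when $\alpha$ is the umbra of $f$, and $E[\alpha^n\gamma^m\cdots\delta^l]=E[\alpha^n]E[\gamma^m]\cdots E[\delta^l]$ for pairwise distinct umbrae. For an umbral polynomial $\mathbf p$ let $f_{\mathbf p}(z)=E[e^{\mathbf p z}]$. Auxiliary umbrae (treated as further umbrae, uncorrelated with all other distinct umbrae): the dot-product umbra $\mathbf p\boldsymbol{\cdot}\mathbf q$ has $f_{\mathbf p\boldsymbol{\cdot}\mathbf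 q}(z)=f_{\mathbf p}(\log f_{\mathbf q}(z))$. The Bell umbra $\beta$ is the umbra of $e^{e^z-1}$, so $f_{\eta\boldsymbol{\cdot}\beta\boldsymbol{\cdot}\rho}(z)=f_\eta(f_\rho(z)-1)$. The derivative umbra $\alpha_D$ satisfies $f_{\alpha_D}(z)=1+zf_\alpha(z)$. For umbrae $\gamma,\alpha$, the Sheffer sequence of $(\gamma,\alpha)$ is the polynomial sequence $s_n(x)=E[(\gamma+x\boldsymbol{\cdot}\beta\boldsymbol{\cdot}\alpha_D)^n]$, i.e. $\sum_{n\ge0}s_n(x)z^n/n!=f_\gamma(z)\,e^{xzf_\alpha(z)}$; this definition also applies when $\gamma,\alpha$ are auxiliary umbrae such as $\gamma+\eta\boldsymbol{\cdot}\beta\boldsymbol{\cdot}\alpha_D$. -}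

module Defs where

open import Level using (Level)
open import Algebra.Bundles using (CommutativeRing)
open import Data.Nat using (ℕ; zero; suc; _∸_)
open import Data.Nat.Combinatorics using (_C_)

-- Umbral calculus over a coefficient ring R (standing for ℂ[𝐱]).
-- An umbra α (umbra of f with f(0)=1) is represented by its moment
-- sequence  mom n = E[α^n] = n! [z^n] f(z)  (an exponential generating
-- function's coefficients); the condition f(0)=1 is  mom 0 ≈ 1#.
module Umbral {c ℓ : Level} (R : CommutativeRing c ℓ) where
  open CommutativeRing R

  nat : ℕ → Carrier
  nat zero    = 0#
  nat (suc n) = 1# + nat n

  sumTo : ℕ → (ℕ → Carrier) → Carrier
  sumTo zero    f = f 0
  sumTo (suc n) f = sumTo n f + f (suc n)

  -- sum of two uncorrelated umbrae:  E[(α+γ)^n] = Σ_i C(n,i) E[α^i] E[γ^(n-i)]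
  _⊕_ : (ℕ → Carrier) → (ℕ → Carrier) → (ℕ → Carrier)
  (a ⊕ b) n = sumTo n (λ i → nat (n C i) * a i * b (n ∸ i))

  minusOne : (ℕ → Carrier) → (ℕ → Carrier)
  minusOne a zero    = 0#
  minusOne a (suc n) = a (suc n)

  -- bell g k n = n! [z^n] g(z)^k / k!   for the egf g with g(0) = 0
  -- (g 0 is ignored). Defined by G_0 = 1, G_{k+1}(0) = 0, G_{k+1}' = g' G_k.
  bell : (ℕ → Carrier) → ℕ → ℕ → Carrier
  bell g zero    zero    = 1#
  bell g zero    (suc n) = 0#
  bell g (suc k) zero    = 0#
  bell g (suc k) (suc n) = sumTo n (λ i → nat (n C i) * g (suc i) * bell g k (n ∸ i))

  -- the umbra η·β·ρ :  f_{η·β·ρ}(z) = f_η(f_ρ(z) - 1)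
  dotBell : (ℕ → Carrier) → (ℕ → Carrier) → (ℕ → Carrier)
  dotBell η ρ n = sumTo n (λ k → η k * bell (minusOne ρ) k n)

  -- derivative umbra α_D :  f_{α_D}(z) = 1 + z f_α(z)
  deriv : (ℕ → Carrier) → (ℕ → Carrier)
  deriv a zero    = 1#
  deriv a (suc n) = nat (suc n) * a n

  -- Sheffer sequence of (γ, α): s_n(x) = E[(γ + x·β·α_D)^n];
  -- sheffer γ α n k = s_{n,k} = coefficient of x^k in s_n(x).
  -- (x·β·α_D has f = exp(x (f_{α_D} - 1)), whose x^k-coefficient is bell (α_D - 1) k.)
  sheffer : (ℕ → Carrier) → (ℕ → Carrier) → ℕ → ℕ → Carrier
  sheffer γ α n k = sumTo n (λ i → nat (n C i) * γ (n ∸ i) * bell (minusOne (deriv α)) k i)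

module Submission where

-- Identify a sequence a with its egf  A(z) = Σ a_n zⁿ/n!.  Then  a ⊕ b  is the
-- product of egfs,  bell g k  is the egf of g(z)ᵏ/k!  and
-- comp a g = Σ_k a_k · bell g k  is the composition A(G(z)) (the constant term
-- of g is ignored).  With  Z a  the egf of  z·A(z)  we have
--   sheffer γ α · k = γ ⊕ bell (Z α) k,   dotBell η (deriv α) = comp η (Z α).
-- The theorem is then a reorganisation of the double sum: the k-sum over
-- s_{n,k} r_{k,j} is the composition of the column (r_{k,j})_k with Z α.

open import Defs
open import Level using (Level; _⊔_)
open import Algebra.Bundles using (CommutativeRing)
open import Data.Nat using (ℕ; zero; suc; _∸_; _≤_; _<_; z≤n; s≤s)
import Data.Nat as ℕ
import Data.Nat.Properties as ℕ
open import Data.Nat.Combinatorics using (_C_; nCk+nC[k+1]≡[n+1]C[k+1]; k>n⇒nCk≡0)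
open import Data.Nat.Induction using (<-rec)
import Relation.Binary.PropositionalEquality as P
import Algebra.Properties.CommutativeSemigroup as CommSemigroupProperties

module SeriesCalculus {c ℓ : Level} (R : CommutativeRing c ℓ) where
  open CommutativeRing R
  open Umbral R
  open import Relation.Binary.Reasoning.Setoid setoid
  open CommSemigroupProperties +-commutativeSemigroup
    using (interchange) renaming (x∙yz≈y∙xz to +-leftComm)
  open CommSemigroupProperties *-commutativeSemigroup
    using () renaming (x∙yz≈y∙xz to *-leftComm; xy∙z≈xz∙y to *-swapʳ)

  Seq : Set c
  Seq = ℕ → Carrier

  _≋_ : Seq → Seq → Set ℓ
  a ≋ b = ∀ n → a n ≈ b n

  -- The shift, i.e. the derivative d/dz of an egf.
  D : Seq → Seq
  D a n = a (suc n)

  𝟙 𝟘 : Seq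
  𝟙 zero    = 1#
  𝟙 (suc n) = 0#
  𝟘 _ = 0#

  _⊞_ : Seq → Seq → Seq
  (a ⊞ b) n = a n + b n

  Σ-cong : ∀ n {f g : ℕ → Carrier} → (∀ i → i ≤ n → f i ≈ g i) → sumTo n f ≈ sumTo n g
  Σ-cong zero    f≈g = f≈g 0 z≤n
  Σ-cong (suc n) f≈g = +-cong (Σ-cong n (λ i i≤n → f≈g i (ℕ.m≤n⇒m≤1+n i≤n))) (f≈g (suc n) ℕ.≤-refl)

  Σ-+ : ∀ n (f g : ℕ → Carrier) → sumTo n (λ i → f i + g i) ≈ sumTo n f + sumTo n g
  Σ-+ zero    f g = refl
  Σ-+ (suc n) f g = trans (+-congʳ (Σ-+ n f g)) (interchange _ _ _ _)

  Σ-*ˡ : ∀ n x (f : ℕ → Carrier) → x * sumTo n f ≈ sumTo n (λ i → x * f i)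
  Σ-*ˡ zero    x f = refl
  Σ-*ˡ (suc n) x f = trans (distribˡ x _ _) (+-congʳ (Σ-*ˡ n x f))

  Σ-zero : ∀ n (f : ℕ → Carrier) → (∀ i → i ≤ n → f i ≈ 0#) → sumTo n f ≈ 0#
  Σ-zero zero    f f≈0 = f≈0 0 z≤n
  Σ-zero (suc n) f f≈0 =
    trans (+-cong (Σ-zero n f (λ i i≤n → f≈0 i (ℕ.m≤n⇒m≤1+n i≤n))) (f≈0 (suc n) ℕ.≤-refl)) (+-identityˡ 0#)

  Σ-peel : ∀ n (f : ℕ → Carrier) → sumTo (suc n) f ≈ f 0 + sumTo n (λ i → f (suc i))
  Σ-peel zero    f = refl
  Σ-peel (suc n) f = trans (+-congʳ (Σ-peel n f)) (+-assoc _ _ _)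

  Σ-swap : ∀ n m (f : ℕ → ℕ → Carrier) →
    sumTo n (λ i → sumTo m (f i)) ≈ sumTo m (λ k → sumTo n (λ i → f i k))
  Σ-swap zero    m f = refl
  Σ-swap (suc n) m f = trans (+-congʳ (Σ-swap n m f)) (sym (Σ-+ m _ _))

  Σ-truncate : ∀ {m N} (f : ℕ → Carrier) → m ≤ N → (∀ k → m < k → f k ≈ 0#) → sumTo N f ≈ sumTo m f
  Σ-truncate {m} {N} f m≤N f≈0 =
    P.subst (λ t → sumTo t f ≈ sumTo m f) (ℕ.m∸n+n≡m m≤N) (extra (N ∸ m))
    where
    extra : ∀ d → sumTo (d ℕ.+ m) f ≈ sumTo m f
    extra zero    = refl
    extra (suc d) = trans (+-cong (extra d) (f≈0 _ (s≤s (ℕ.m≤n+m m d)))) (+-identityʳ _)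

  nat-+ : ∀ m n → nat (m ℕ.+ n) ≈ nat m + nat n
  nat-+ zero    n = sym (+-identityˡ _)
  nat-+ (suc m) n = trans (+-congˡ (nat-+ m n)) (sym (+-assoc _ _ _))

  nat-1 : nat 1 ≈ 1#
  nat-1 = +-identityʳ 1#

  pascal : ∀ n k → nat (suc n C suc k) ≈ nat (n C k) + nat (n C suc k)
  pascal n k = P.subst (λ t → nat t ≈ nat (n C k) + nat (n C suc k))
                       (nCk+nC[k+1]≡[n+1]C[k+1] n k) (nat-+ (n C k) (n C suc k))

  ⊕-cong : ∀ n {a a' b b' : Seq} → (∀ m → m ≤ n → a m ≈ a' m) → (∀ m → m ≤ n → b m ≈ b' m) →
    (a ⊕ b) n ≈ (a' ⊕ b') n
  ⊕-cong n a≈ b≈ = Σ-cong n (λ i i≤n → *-cong (*-congˡ (a≈ i i≤n)) (b≈ (n ∸ i) (ℕ.m∸n≤m n i)))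

  ⊕-congʳ : ∀ n a {b b' : Seq} → (∀ m → m ≤ n → b m ≈ b' m) → (a ⊕ b) n ≈ (a ⊕ b') n
  ⊕-congʳ n a b≈ = ⊕-cong n {a = a} {a' = a} (λ _ _ → refl) b≈

  ⊕-congˡ : ∀ n {a a' : Seq} b → (∀ m → m ≤ n → a m ≈ a' m) → (a ⊕ b) n ≈ (a' ⊕ b) n
  ⊕-congˡ n b a≈ = ⊕-cong n {b = b} {b' = b} a≈ (λ _ _ → refl)

  ⊕-at-0 : ∀ a b → (a ⊕ b) 0 ≈ a 0 * b 0
  ⊕-at-0 a b = *-congʳ (trans (*-congʳ nat-1) (*-identityˡ _))

  ⊕-shiftʳ : ∀ a b n → (a ⊕ D b) n ≈
    nat 1 * a 0 * b (suc n) + sumTo n (λ k → nat (n C suc k) * a (suc k) * b (n ∸ k))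
  ⊕-shiftʳ a b zero =
    sym (trans (+-congˡ (trans (*-congʳ (zeroˡ _)) (zeroˡ _))) (+-identityʳ _))
  ⊕-shiftʳ a b (suc m) = begin
    (a ⊕ D b) (suc m)
      ≈⟨ Σ-peel m _ ⟩
    nat 1 * a 0 * b (suc (suc m)) + sumTo m (λ k → nat (suc m C suc k) * a (suc k) * b (suc (m ∸ k)))
      ≈⟨ +-congˡ (Σ-cong m (λ k k≤m → *-congˡ (reflexive (P.cong b (P.sym (ℕ.+-∸-assoc 1 k≤m)))))) ⟩
    nat 1 * a 0 * b (suc (suc m)) + sumTo m (λ k → nat (suc m C suc k) * a (suc k) * b (suc m ∸ k))
      ≈⟨ +-congˡ (sym (trans (+-congˡ last≈0) (+-identityʳ _))) ⟩
    nat 1 * a 0 * b (suc (suc m)) + sumTo (suc m) (λ k → nat (suc m C suc k) * a (suc k) * b (suc m ∸ k)) ∎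
    where
    last≈0 : nat (suc m C suc (suc m)) * a (suc (suc m)) * b (suc m ∸ suc m) ≈ 0#
    last≈0 = trans (*-congʳ (trans (*-congʳ (reflexive (P.cong nat (k>n⇒nCk≡0 (ℕ.n<1+n (suc m))))))
                                   (zeroˡ _)))
                   (zeroˡ _)

  leibniz : ∀ a b n → (a ⊕ b) (suc n) ≈ (D a ⊕ b) n + (a ⊕ D b) n
  leibniz a b n = begin
    (a ⊕ b) (suc n)
      ≈⟨ Σ-peel n _ ⟩
    head + sumTo n (λ k → nat (suc n C suc k) * a (suc k) * b (n ∸ k))
      ≈⟨ +-congˡ (Σ-cong n (λ k _ → pascal-split k)) ⟩
    head + sumTo n (λ k → nat (n C k) * a (suc k) * b (n ∸ k) + nat (n C suc k) * a (suc k) * b (n ∸ k))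
      ≈⟨ +-congˡ (Σ-+ n _ _) ⟩
    head + ((D a ⊕ b) n + rest)
      ≈⟨ +-leftComm _ _ _ ⟩
    (D a ⊕ b) n + (head + rest)
      ≈⟨ +-congˡ (sym (⊕-shiftʳ a b n)) ⟩
    (D a ⊕ b) n + (a ⊕ D b) n ∎
    where
    head rest : Carrier
    head = nat 1 * a 0 * b (suc n)
    rest = sumTo n (λ k → nat (n C suc k) * a (suc k) * b (n ∸ k))
    pascal-split : ∀ k → nat (suc n C suc k) * a (suc k) * b (n ∸ k) ≈
      nat (n C k) * a (suc k) * b (n ∸ k) + nat (n C suc k) * a (suc k) * b (n ∸ k)
    pascal-split k = trans (*-congʳ (trans (*-congʳ (pascal n k)) (distribʳ _ _ _))) (distribʳ _ _ _)

  ⊕-distribʳ : ∀ a b d → ((a ⊞ b) ⊕ d) ≋ ((a ⊕ d) ⊞ (b ⊕ d))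
  ⊕-distribʳ a b d n = trans (Σ-cong n (λ i _ → trans (*-congʳ (distribˡ _ _ _)) (distribʳ _ _ _))) (Σ-+ n _ _)

  ⊕-distribˡ : ∀ a b d → (a ⊕ (b ⊞ d)) ≋ ((a ⊕ b) ⊞ (a ⊕ d))
  ⊕-distribˡ a b d n = trans (Σ-cong n (λ i _ → distribˡ _ _ _)) (Σ-+ n _ _)

  ⊕-zeroˡ : ∀ a → (𝟘 ⊕ a) ≋ 𝟘
  ⊕-zeroˡ a n = Σ-zero n _ (λ i _ → trans (*-congʳ (zeroʳ _)) (zeroˡ _))

  ⊕-zeroʳ : ∀ a → (a ⊕ 𝟘) ≋ 𝟘
  ⊕-zeroʳ a n = Σ-zero n _ (λ i _ → zeroʳ _)

  -- (Seq, ⊕, 𝟙) is a commutative monoid; each law follows by induction on the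
  -- coefficient index through the Leibniz rule.
  ⊕-comm : ∀ a b → (a ⊕ b) ≋ (b ⊕ a)
  ⊕-comm a b zero = *-swapʳ _ _ _
  ⊕-comm a b (suc n) = begin
    (a ⊕ b) (suc n)           ≈⟨ leibniz a b n ⟩
    (D a ⊕ b) n + (a ⊕ D b) n ≈⟨ +-cong (⊕-comm (D a) b n) (⊕-comm a (D b) n) ⟩
    (b ⊕ D a) n + (D b ⊕ a) n ≈⟨ +-comm _ _ ⟩
    (D b ⊕ a) n + (b ⊕ D a) n ≈⟨ sym (leibniz b a n) ⟩
    (b ⊕ a) (suc n)           ∎

  ⊕-identityˡ : ∀ a → (𝟙 ⊕ a) ≋ a
  ⊕-identityˡ a zero    = trans (⊕-at-0 𝟙 a) (*-identityˡ _)
  ⊕-identityˡ a (suc n) = begin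
    (𝟙 ⊕ a) (suc n)           ≈⟨ leibniz 𝟙 a n ⟩
    (𝟘 ⊕ a) n + (𝟙 ⊕ D a) n   ≈⟨ +-cong (⊕-zeroˡ a n) (⊕-identityˡ (D a) n) ⟩
    0# + a (suc n)            ≈⟨ +-identityˡ _ ⟩
    a (suc n)                 ∎

  ⊕-identityʳ : ∀ a → (a ⊕ 𝟙) ≋ a
  ⊕-identityʳ a n = trans (⊕-comm a 𝟙 n) (⊕-identityˡ a n)

  ⊕-assoc : ∀ a b d → ((a ⊕ b) ⊕ d) ≋ (a ⊕ (b ⊕ d))
  ⊕-assoc a b d zero = begin
    ((a ⊕ b) ⊕ d) 0 ≈⟨ trans (⊕-at-0 (a ⊕ b) d) (*-congʳ (⊕-at-0 a b)) ⟩
    a 0 * b 0 * d 0 ≈⟨ *-assoc _ _ _ ⟩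
    a 0 * (b 0 * d 0) ≈⟨ sym (trans (⊕-at-0 a (b ⊕ d)) (*-congˡ (⊕-at-0 b d))) ⟩
    (a ⊕ (b ⊕ d)) 0 ∎
  ⊕-assoc a b d (suc n) = begin
    ((a ⊕ b) ⊕ d) (suc n)
      ≈⟨ leibniz (a ⊕ b) d n ⟩
    (D (a ⊕ b) ⊕ d) n + ((a ⊕ b) ⊕ D d) n
      ≈⟨ +-congʳ (trans (⊕-congˡ n d (λ m _ → leibniz a b m)) (⊕-distribʳ (D a ⊕ b) (a ⊕ D b) d n)) ⟩
    (((D a ⊕ b) ⊕ d) n + ((a ⊕ D b) ⊕ d) n) + ((a ⊕ b) ⊕ D d) n
      ≈⟨ +-cong (+-cong (⊕-assoc (D a) b d n) (⊕-assoc a (D b) d n)) (⊕-assoc a b (D d) n) ⟩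
    ((D a ⊕ (b ⊕ d)) n + (a ⊕ (D b ⊕ d)) n) + (a ⊕ (b ⊕ D d)) n
      ≈⟨ +-assoc _ _ _ ⟩
    (D a ⊕ (b ⊕ d)) n + ((a ⊕ (D b ⊕ d)) n + (a ⊕ (b ⊕ D d)) n)
      ≈⟨ +-congˡ (trans (sym (⊕-distribˡ a (D b ⊕ d) (b ⊕ D d) n))
                        (⊕-congʳ n a (λ m _ → sym (leibniz b d m)))) ⟩
    (D a ⊕ (b ⊕ d)) n + (a ⊕ D (b ⊕ d)) n
      ≈⟨ sym (leibniz a (b ⊕ d) n) ⟩
    (a ⊕ (b ⊕ d)) (suc n) ∎

  -- A linear combination Σ_k c_k S_k of sequences S_k whose first k terms
  -- vanish is well defined coefficientwise as a finite sum.
  lincomb : (ℕ → Carrier) → (ℕ → Seq) → Seq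
  lincomb w S m = sumTo m (λ k → w k * S k m)

  comp : Seq → Seq → Seq
  comp a g = lincomb a (bell g)

  bell-vanish : ∀ g k n → n < k → bell g k n ≈ 0#
  bell-vanish g (suc k) zero    _          = refl
  bell-vanish g (suc k) (suc n) (s≤s n<k) =
    Σ-zero n _ (λ i _ → trans (*-congˡ (bell-vanish g k (n ∸ i) (ℕ.≤-<-trans (ℕ.m∸n≤m n i) n<k))) (zeroʳ _))

  bell-cong : ∀ g g' → (∀ n → g (suc n) ≈ g' (suc n)) → ∀ k → bell g k ≋ bell g' k
  bell-cong g g' g≈ zero    zero    = refl
  bell-cong g g' g≈ zero    (suc n) = refl
  bell-cong g g' g≈ (suc k) zero    = refl
  bell-cong g g' g≈ (suc k) (suc n) = Σ-cong n (λ i _ → *-cong (*-congˡ (g≈ i)) (bell-cong g g' g≈ k (n ∸ i)))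

  bell-zero : ∀ g → bell g 0 ≋ 𝟙
  bell-zero g zero    = refl
  bell-zero g (suc n) = refl

  ⊕-lincomb : ∀ X (S : ℕ → Seq) (w : ℕ → Carrier) → (∀ k m → m < k → S k m ≈ 0#) → ∀ n →
    sumTo n (λ k → w k * (X ⊕ S k) n) ≈ (X ⊕ lincomb w S) n
  ⊕-lincomb X S w S-vanish n = begin
    sumTo n (λ k → w k * (X ⊕ S k) n)
      ≈⟨ Σ-cong n (λ k _ → Σ-*ˡ n (w k) _) ⟩
    sumTo n (λ k → sumTo n (λ i → w k * (nat (n C i) * X i * S k (n ∸ i))))
      ≈⟨ Σ-swap n n _ ⟩
    sumTo n (λ i → sumTo n (λ k → w k * (nat (n C i) * X i * S k (n ∸ i))))
      ≈⟨ Σ-cong n (λ i i≤n → inner i i≤n) ⟩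
    (X ⊕ lincomb w S) n ∎
    where
    inner : ∀ i → i ≤ n → sumTo n (λ k → w k * (nat (n C i) * X i * S k (n ∸ i))) ≈
      nat (n C i) * X i * lincomb w S (n ∸ i)
    inner i i≤n = begin
      sumTo n (λ k → w k * (nat (n C i) * X i * S k (n ∸ i)))
        ≈⟨ Σ-cong n (λ k _ → *-leftComm _ _ _) ⟩
      sumTo n (λ k → nat (n C i) * X i * (w k * S k (n ∸ i)))
        ≈⟨ sym (Σ-*ˡ n _ _) ⟩
      nat (n C i) * X i * sumTo n (λ k → w k * S k (n ∸ i))
        ≈⟨ *-congˡ (Σ-truncate _ (ℕ.m∸n≤m n i) (λ k lt → trans (*-congˡ (S-vanish k (n ∸ i) lt)) (zeroʳ _))) ⟩
      nat (n C i) * X i * lincomb w S (n ∸ i) ∎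

  comp-chain : ∀ a g n → comp a g (suc n) ≈ (D g ⊕ comp (D a) g) n
  comp-chain a g n = begin
    comp a g (suc n)
      ≈⟨ Σ-peel n _ ⟩
    a 0 * 0# + sumTo n (λ k → a (suc k) * (D g ⊕ bell g k) n)
      ≈⟨ trans (+-congʳ (zeroʳ _)) (+-identityˡ _) ⟩
    sumTo n (λ k → a (suc k) * (D g ⊕ bell g k) n)
      ≈⟨ ⊕-lincomb (D g) (bell g) (D a) (bell-vanish g) n ⟩
    (D g ⊕ comp (D a) g) n ∎

  comp-congˡ : ∀ {a a'} g → a ≋ a' → comp a g ≋ comp a' g
  comp-congˡ g a≈ n = Σ-cong n (λ k _ → *-congʳ (a≈ k))

  comp-⊞ : ∀ a b g → comp (a ⊞ b) g ≋ (comp a g ⊞ comp b g)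
  comp-⊞ a b g n = trans (Σ-cong n (λ k _ → distribʳ _ _ _)) (Σ-+ n _ _)

  comp-𝟘 : ∀ g → comp 𝟘 g ≋ 𝟘
  comp-𝟘 g n = Σ-zero n _ (λ k _ → zeroˡ _)

  comp-𝟙 : ∀ g → comp 𝟙 g ≋ 𝟙
  comp-𝟙 g zero    = *-identityˡ _
  comp-𝟙 g (suc n) = begin
    comp 𝟙 g (suc n)    ≈⟨ comp-chain 𝟙 g n ⟩
    (D g ⊕ comp 𝟘 g) n  ≈⟨ ⊕-congʳ n (D g) (λ m _ → comp-𝟘 g m) ⟩
    (D g ⊕ 𝟘) n         ≈⟨ ⊕-zeroʳ (D g) n ⟩
    0#                  ∎

  -- Composition with g is multiplicative: (AB)∘G = (A∘G)(B∘G).  By strong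
  -- induction on the index, using the chain and Leibniz rules.
  comp-⊕ : ∀ a b g → comp (a ⊕ b) g ≋ (comp a g ⊕ comp b g)
  comp-⊕ a b g n = <-rec Multiplicative step n a b
    where
    Multiplicative : ℕ → Set (c ⊔ ℓ)
    Multiplicative n = ∀ a b → comp (a ⊕ b) g n ≈ (comp a g ⊕ comp b g) n

    step : ∀ n → (∀ {m} → m < n → Multiplicative m) → Multiplicative n
    step zero    _  a b = begin
      comp (a ⊕ b) g 0      ≈⟨ trans (*-identityʳ _) (⊕-at-0 a b) ⟩
      a 0 * b 0             ≈⟨ sym (*-cong (*-identityʳ _) (*-identityʳ _)) ⟩
      comp a g 0 * comp b g 0 ≈⟨ sym (⊕-at-0 (comp a g) (comp b g)) ⟩
      (comp a g ⊕ comp b g) 0 ∎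
    step (suc n) ih a b = begin
      comp (a ⊕ b) g (suc n)
        ≈⟨ comp-chain (a ⊕ b) g n ⟩
      (D g ⊕ comp (D (a ⊕ b)) g) n
        ≈⟨ ⊕-congʳ n (D g) (λ m _ → trans (comp-congˡ g (leibniz a b) m) (comp-⊞ (D a ⊕ b) (a ⊕ D b) g m)) ⟩
      (D g ⊕ (comp (D a ⊕ b) g ⊞ comp (a ⊕ D b) g)) n
        ≈⟨ ⊕-congʳ n (D g) (λ m m≤n → +-cong (ih (s≤s m≤n) (D a) b) (ih (s≤s m≤n) a (D b))) ⟩
      (D g ⊕ ((cDa ⊕ cb) ⊞ (ca ⊕ cDb))) n
        ≈⟨ ⊕-distribˡ (D g) (cDa ⊕ cb) (ca ⊕ cDb) n ⟩
      (D g ⊕ (cDa ⊕ cb)) n + (D g ⊕ (ca ⊕ cDb)) n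
        ≈⟨ +-cong (sym (⊕-assoc (D g) cDa cb n)) move-Dg ⟩
      ((D g ⊕ cDa) ⊕ cb) n + (ca ⊕ (D g ⊕ cDb)) n
        ≈⟨ +-cong (⊕-congˡ n cb (λ m _ → sym (comp-chain a g m)))
                  (⊕-congʳ n ca (λ m _ → sym (comp-chain b g m))) ⟩
      (D ca ⊕ cb) n + (ca ⊕ D cb) n
        ≈⟨ sym (leibniz ca cb n) ⟩
      (ca ⊕ cb) (suc n) ∎
      where
      ca cb cDa cDb : Seq
      ca = comp a g
      cb = comp b g
      cDa = comp (D a) g
      cDb = comp (D b) g
      move-Dg : (D g ⊕ (ca ⊕ cDb)) n ≈ (ca ⊕ (D g ⊕ cDb)) n
      move-Dg = begin
        (D g ⊕ (ca ⊕ cDb)) n ≈⟨ sym (⊕-assoc (D g) ca cDb n) ⟩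
        ((D g ⊕ ca) ⊕ cDb) n ≈⟨ ⊕-congˡ n cDb (λ m _ → ⊕-comm (D g) ca m) ⟩
        ((ca ⊕ D g) ⊕ cDb) n ≈⟨ ⊕-assoc ca (D g) cDb n ⟩
        (ca ⊕ (D g ⊕ cDb)) n ∎

  comp-bell : ∀ h g j → comp (bell h j) g ≋ bell (comp h g) j
  comp-bell h g zero    n = trans (comp-congˡ g (bell-zero h) n) (trans (comp-𝟙 g n) (sym (bell-zero (comp h g) n)))
  comp-bell h g (suc j) zero    = zeroˡ _
  comp-bell h g (suc j) (suc n) = begin
    comp (bell h (suc j)) g (suc n)
      ≈⟨ comp-chain (bell h (suc j)) g n ⟩
    (D g ⊕ comp (D h ⊕ bell h j) g) n
      ≈⟨ ⊕-congʳ n (D g) (λ m _ → trans (comp-⊕ (D h) (bell h j) g m)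
                                        (⊕-congʳ m (comp (D h) g) (λ k _ → comp-bell h g j k))) ⟩
    (D g ⊕ (comp (D h) g ⊕ bell (comp h g) j)) n
      ≈⟨ sym (⊕-assoc (D g) (comp (D h) g) (bell (comp h g) j) n) ⟩
    ((D g ⊕ comp (D h) g) ⊕ bell (comp h g) j) n
      ≈⟨ ⊕-congˡ n (bell (comp h g) j) (λ m _ → sym (comp-chain h g m)) ⟩
    bell (comp h g) (suc j) (suc n) ∎

  -- Z a is the egf of z·A(z), i.e. f_{α_D} - 1 for the umbra α of A.
  Z : Seq → Seq
  Z a = minusOne (deriv a)

  Z-derivative : ∀ a n → Z a (suc n) ≈ a n + Z (D a) n
  Z-derivative a zero    = trans (trans (*-congʳ nat-1) (*-identityˡ _)) (sym (+-identityʳ _))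
  Z-derivative a (suc n) = trans (distribʳ _ _ _) (+-congʳ (*-identityˡ _))

  Z-𝟙-derivative : D (Z 𝟙) ≋ 𝟙
  Z-𝟙-derivative zero    = trans (*-congʳ nat-1) (*-identityˡ _)
  Z-𝟙-derivative (suc n) = zeroʳ _

  Z-as-product : ∀ a → Z a ≋ (Z 𝟙 ⊕ a)
  Z-as-product a zero    = sym (trans (*-congʳ (zeroʳ _)) (zeroˡ _))
  Z-as-product a (suc n) = begin
    Z a (suc n)                   ≈⟨ Z-derivative a n ⟩
    a n + Z (D a) n               ≈⟨ +-cong (sym (⊕-identityˡ a n)) (Z-as-product (D a) n) ⟩
    (𝟙 ⊕ a) n + (Z 𝟙 ⊕ D a) n     ≈⟨ +-congʳ (⊕-congˡ n a (λ m _ → sym (Z-𝟙-derivative m))) ⟩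
    (D (Z 𝟙) ⊕ a) n + (Z 𝟙 ⊕ D a) n ≈⟨ sym (leibniz (Z 𝟙) a n) ⟩
    (Z 𝟙 ⊕ a) (suc n)             ∎

  comp-Z-𝟙 : ∀ g → g 0 ≈ 0# → comp (Z 𝟙) g ≋ g
  comp-Z-𝟙 g g0≈0 zero    = trans (zeroˡ _) (sym g0≈0)
  comp-Z-𝟙 g g0≈0 (suc n) = begin
    comp (Z 𝟙) g (suc n)         ≈⟨ comp-chain (Z 𝟙) g n ⟩
    (D g ⊕ comp (D (Z 𝟙)) g) n   ≈⟨ ⊕-congʳ n (D g) (λ m _ → trans (comp-congˡ g Z-𝟙-derivative m) (comp-𝟙 g m)) ⟩
    (D g ⊕ 𝟙) n                  ≈⟨ ⊕-identityʳ (D g) n ⟩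
    g (suc n)                    ∎

  -- (z D)∘(z A) = z A · (D∘(z A)), the composed "delta series" of the theorem.
  Z-comp-Z : ∀ α δ → comp (Z δ) (Z α) ≋ Z (α ⊕ comp δ (Z α))
  Z-comp-Z α δ n = begin
    comp (Z δ) g n            ≈⟨ comp-congˡ g (Z-as-product δ) n ⟩
    comp (Z 𝟙 ⊕ δ) g n        ≈⟨ comp-⊕ (Z 𝟙) δ g n ⟩
    (comp (Z 𝟙) g ⊕ Cδ) n     ≈⟨ ⊕-congˡ n Cδ (λ m _ → trans (comp-Z-𝟙 g refl m) (Z-as-product α m)) ⟩
    ((Z 𝟙 ⊕ α) ⊕ Cδ) n        ≈⟨ ⊕-assoc (Z 𝟙) α Cδ n ⟩
    (Z 𝟙 ⊕ (α ⊕ Cδ)) n        ≈⟨ sym (Z-as-product (α ⊕ Cδ) n) ⟩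
    Z (α ⊕ Cδ) n              ∎
    where
    g Cδ : Seq
    g = Z α
    Cδ = comp δ g

  sheffer-column : ∀ γ α n k → sheffer γ α n k ≈ (γ ⊕ bell (Z α) k) n
  sheffer-column γ α n k = trans (Σ-cong n (λ i _ → *-swapʳ _ _ _)) (⊕-comm (bell (Z α) k) γ n)

  sheffer-comp : ∀ η δ j g →
    comp (λ k → sheffer η δ k j) g ≋ (comp η g ⊕ bell (comp (Z δ) g) j)
  sheffer-comp η δ j g m = begin
    comp (λ k → sheffer η δ k j) g m ≈⟨ comp-congˡ g (λ k → sheffer-column η δ k j) m ⟩
    comp (η ⊕ bell (Z δ) j) g m      ≈⟨ comp-⊕ η (bell (Z δ) j) g m ⟩
    (comp η g ⊕ comp (bell (Z δ) j) g) m ≈⟨ ⊕-congʳ m (comp η g) (λ k _ → comp-bell (Z δ) g j k) ⟩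
    (comp η g ⊕ bell (comp (Z δ) g) j) m ∎

  umbral-composition : ∀ γ α η δ n j →
    sumTo n (λ k → sheffer γ α n k * sheffer η δ k j)
      ≈ sheffer (γ ⊕ dotBell η (deriv α)) (α ⊕ dotBell δ (deriv α)) n j
  umbral-composition γ α η δ n j = begin
    sumTo n (λ k → sheffer γ α n k * r k)
      ≈⟨ Σ-cong n (λ k _ → trans (*-comm _ _) (*-congˡ (sheffer-column γ α n k))) ⟩
    sumTo n (λ k → r k * (γ ⊕ bell g k) n)
      ≈⟨ ⊕-lincomb γ (bell g) r (bell-vanish g) n ⟩
    (γ ⊕ comp r g) n
      ≈⟨ ⊕-congʳ n γ (λ m _ → column-comp m) ⟩
    (γ ⊕ (Cη ⊕ bell (Z (α ⊕ comp δ g)) j)) n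
      ≈⟨ sym (⊕-assoc γ Cη (bell (Z (α ⊕ comp δ g)) j) n) ⟩
    ((γ ⊕ Cη) ⊕ bell (Z (α ⊕ comp δ g)) j) n
      ≈⟨ sym (sheffer-column (γ ⊕ Cη) (α ⊕ comp δ g) n j) ⟩
    sheffer (γ ⊕ dotBell η (deriv α)) (α ⊕ dotBell δ (deriv α)) n j ∎
    where
    g Cη : Seq
    g = Z α
    Cη = comp η g
    r : ℕ → Carrier
    r k = sheffer η δ k j
    column-comp : comp r g ≋ (Cη ⊕ bell (Z (α ⊕ comp δ g)) j)
    column-comp m = trans (sheffer-comp η δ j g m)
      (⊕-congʳ m Cη (λ i _ → bell-cong (comp (Z δ) g) (Z (α ⊕ comp δ g)) (λ k → Z-comp-Z α δ (suc k)) j i))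

mainTheorem8 : ∀ {c ℓ : Level} (R : CommutativeRing c ℓ) →
    let open CommutativeRing R
        open Umbral R
    in (γ α η δ : ℕ → Carrier) →
       γ 0 ≈ 1# → α 0 ≈ 1# → η 0 ≈ 1# → δ 0 ≈ 1# →
       ∀ (n j : ℕ) →
       sumTo n (λ k → sheffer γ α n k * sheffer η δ k j)
         ≈ sheffer (γ ⊕ dotBell η (deriv α)) (α ⊕ dotBell δ (deriv α)) n j
mainTheorem8 R γ α η δ _ _ _ _ = SeriesCalculus.umbral-composition R γ α η δ
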